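{- Let $\mathcal{P}=(Q,T)$ be a replicated system and let $\mathcal{C},\mathcal{C}'$ be inductive sets of configurations of $\mathcal{P}$. Then $\mathcal{C}$ leads to $\mathcal{C}'$ if and only if there exists a certificate for $\mathcal{C}\leadsto\mathcal{C}'$.
   Context: A replicated system of arity $n$ over a finite set $Q$ is a pair $\mathcal{P}=(Q,T)$ with $T\subseteq\bigcup_{k=0}^n Q^{(k)}\times Q^{(k)}$ ($Q^{(k)}$ = multisets over $Q$ of size $k$), containing every silent pair $(x,x)$, $x\in Q^{(k)}$, $k\le n$. Configurations are multisets $C\in\mathbb{N}^Q$. For $t=(x,y)\in T$, $t$ is enabled at $C$ if $C\ge x$ componentwise, and then $C\xrightarrow{t}C-x+y$. Write $C\to C'$ if $C\xrightarrow{t}C'$ for some $t\in T$, and $\xrightarrow{*}$ for the reflexive–transitive closure. A run is an infinite sequence $C_0t_1C_1t_2\cdots$ with $C_i\xrightarrow{t_{i+1}}C_{i+1}$. A run is fair if for every step $C\xrightarrow{t}C'$ of $\mathcal{P}$: if the run contains infinitely many occurrences of $C$, then it contains infinitely many occurrences of the consecutive triple $C\,t\,C'$. A set $\mathcal{C}$ of configurations is inductive if $C\in\mathcal{C}$ and $C\to C'$ imply $C'\in\mathcal{C}$. $\mathcal{C}$ leads to $\mathcal{C}'$ (written $\mathcal{C}\leadsto\mathcal{C}'$) if for every $C\in\mathcal{C}$, every fair run starting at $C$ eventually visits a configuration of $\mathcal{C}'$. A certificate for $\mathcal{C}\leadsto\mathcal{C}'$ is a function $f:\mathcal{C}\to\mathbb{N}$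 such that for every $C\in\mathcal{C}\setminus\mathcal{C}'$ there exists an execution $C\xrightarrow{*}D$ with $f(C)>f(D)$. -}

module Defs where

open import Level using (0ℓ)
open import Data.Nat using (ℕ; suc; _+_; _∸_; _≤_; _<_)
open import Data.Vec using (Vec; zipWith; sum)
open import Data.Vec.Relation.Binary.Pointwise.Inductive using (Pointwise)
open import Data.Product using (Σ; ∃; _×_; _,_; proj₁; proj₂)
open import Relation.Binary.PropositionalEquality using (_≡_)
open import Relation.Binary.Construct.Closure.ReflexiveTransitive using (Star)
open import Relation.Nullary using (¬_)

-- The finite set Q of states is represented as Fin q (q = |Q|).
-- A configuration (multiset over Q) is a vector of multiplicities.
Config : ℕ → Set
Config q = Vec ℕ q

size : ∀ {q} → Config q → ℕ
size = sum

_≼_ : ∀ {q} → Config q → Config q → Set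
x ≼ y = Pointwise _≤_ x y

record ReplicatedSystem (q n : ℕ) : Set₁ where
  field
    T        : Config q → Config q → Set
    T-size   : ∀ x y → T x y → size x ≡ size y
    T-arity  : ∀ x y → T x y → size x ≤ n
    T-silent : ∀ x → size x ≤ n → T x x

module _ {q n : ℕ} (P : ReplicatedSystem q n) where
  open ReplicatedSystem P

  Transition : Set
  Transition = Config q × Config q

  Step : Config q → Transition → Config q → Set
  Step C (x , y) C' = T x y × (x ≼ C) × (C' ≡ zipWith _+_ (zipWith _∸_ C x) y)

  _⟶_ : Config q → Config q → Set
  C ⟶ C' = ∃ λ t → Step C t C'

  _⟶*_ : Config q → Config q → Set
  _⟶*_ = Star _⟶_

  record Run : Set where
    field
      conf  : ℕ → Config q
      trans : ℕ → Transition      -- trans i is the transition t_{i+1}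
      step  : ∀ i → Step (conf i) (trans i) (conf (suc i))
  open Run public

  InfinitelyOften : (ℕ → Set) → Set
  InfinitelyOften A = ∀ N → ∃ λ i → N ≤ i × A i

  Fair : Run → Set
  Fair r = ∀ C t C' → Step C t C' →
    InfinitelyOften (λ i → conf r i ≡ C) →
    InfinitelyOften (λ i → conf r i ≡ C × trans r i ≡ t × conf r (suc i) ≡ C')

  ConfigSet : Set₁
  ConfigSet = Config q → Set

  Inductive : ConfigSet → Set
  Inductive 𝒞 = ∀ C C' → 𝒞 C → C ⟶ C' → 𝒞 C'

  LeadsTo : ConfigSet → ConfigSet → Set
  LeadsTo 𝒞 𝒞' = ∀ C → 𝒞 C → (r : Run) → conf r 0 ≡ C → Fair r →
    ∃ λ i → 𝒞' (conf r i)

  Certificate : (𝒞 𝒞' : ConfigSet) → ((C : Config q) → 𝒞 C → ℕ) → Set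
  Certificate 𝒞 𝒞' f = ∀ C (h : 𝒞 C) → ¬ 𝒞' C →
    ∃ λ D → Σ (C ⟶* D) λ _ → Σ (𝒞 D) λ hD → f D hD < f C h

-- Steps preserve the size of a configuration, so a run stays inside the finite set of
-- configurations of its initial size.
--
-- (⇐) A fair run from C ∈ 𝒞 therefore visits some D ∈ 𝒞 infinitely often, and fairness
-- propagates "visited infinitely often" along executions. If the run avoided 𝒞', the
-- certificate would give D ⟶* D₁ ⟶* D₂ ⋯ with f D > f D₁ > f D₂ > ⋯, all visited
-- infinitely often: impossible.
--
-- (⇒) Let f C be the least length of an execution from C into 𝒞'. It exists because every
-- configuration has a fair run: in phase k, walk to the source of the k-th step of a cyclic
-- enumeration of all steps between configurations of the initial size, if it is reachable,
-- and fire it. If C ∉ 𝒞', the first step of a shortest execution decreases f.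

module Submission where

open import Defs
open import Level using (0ℓ)
open import Axiom.ExcludedMiddle using (ExcludedMiddle)
open import Axiom.DoubleNegationElimination using (DoubleNegationElimination; em⇒dne)
open import Data.Nat using (ℕ; zero; suc; _+_; _∸_; _*_; _≤_; _<_; z≤n; s≤s)
open import Data.Nat.Properties
open import Algebra.Properties.CommutativeSemigroup +-commutativeSemigroup using (interchange)
open import Data.Nat.DivMod using (_%_; _mod_; [m+kn]%n≡m%n; m<n⇒m%n≡m)
open import Data.Nat.Induction using (<-wellFounded)
open import Induction.WellFounded using (Acc; acc)
open import Data.Fin using (Fin; toℕ)
open import Data.Fin.Properties using (toℕ-injective; toℕ-fromℕ<; toℕ<n)
open import Data.Vec using (Vec; []; _∷_; zipWith; replicate)
open import Data.Vec.Properties using (zipWith-identityʳ)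
open import Data.Vec.Relation.Binary.Pointwise.Inductive using ([]; _∷_)
open import Data.List using (List; []; _∷_; length; lookup; upTo; cartesianProduct; cartesianProductWith)
open import Data.List.Membership.Propositional using (_∈_)
open import Data.List.Membership.Propositional.Properties
  using (∈-upTo⁺; ∈-cartesianProductWith⁺; ∈-cartesianProduct⁺)
open import Data.List.Relation.Unary.Any as Any using (Any; here; there)
open import Data.List.Relation.Unary.Any.Properties using (lookup-index)
open import Data.Product using (Σ; ∃; _×_; _,_; proj₁; proj₂; curry)
open import Data.Product.Properties using (,-injective)
open import Data.Sum using (_⊎_; inj₁; inj₂; [_,_]′)
open import Data.Empty using (⊥-elim)
open import Function using (_∘_; id)
open import Function.Bundles using (_⇔_; mk⇔)
open import Relation.Binary.PropositionalEquality using (_≡_; refl; sym; cong; cong₂; subst; subst₂; module ≡-Reasoning)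
import Relation.Binary.PropositionalEquality as ≡
open import Relation.Binary.Construct.Closure.ReflexiveTransitive using (ε; _◅_; _◅◅_)
open import Relation.Nullary using (¬_; Dec; yes; no)

-- Definitionally equal to InfinitelyOften P, which does not depend on P.
Unbounded : (ℕ → Set) → Set
Unbounded A = ∀ N → ∃ λ i → N ≤ i × A i

unbounded-map : ∀ {A B : ℕ → Set} → (∀ i → A i → B i) → Unbounded A → Unbounded B
unbounded-map f A-unbounded N = let (i , N≤i , Ai) = A-unbounded N in i , N≤i , f i Ai

mod-unbounded : ∀ {m} (i : Fin (suc m)) → Unbounded (λ k → k mod suc m ≡ i)
mod-unbounded {m} i N = toℕ i + N * suc m , N≤k , toℕ-injective (begin
    toℕ ((toℕ i + N * suc m) mod suc m) ≡⟨ toℕ-fromℕ< _ ⟩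
    (toℕ i + N * suc m) % suc m          ≡⟨ [m+kn]%n≡m%n (toℕ i) N (suc m) ⟩
    toℕ i % suc m                        ≡⟨ m<n⇒m%n≡m (toℕ<n i) ⟩
    toℕ i                                ∎)
  where
  open ≡-Reasoning
  N≤k : N ≤ toℕ i + N * suc m
  N≤k = ≤-trans (m≤m*n N (suc m)) (m≤n+m (N * suc m) (toℕ i))

module _ {A : Set} (x₀ : A) (xs : List A) where

  cycle : ℕ → A
  cycle k = lookup (x₀ ∷ xs) (k mod suc (length xs))

  cycle-unbounded : ∀ {x} → x ∈ xs → Unbounded (λ k → cycle k ≡ x)
  cycle-unbounded {x} x∈xs = unbounded-map cycle-hits (mod-unbounded (Any.index x∈x₀∷xs))
    where
    x∈x₀∷xs : x ∈ x₀ ∷ xs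
    x∈x₀∷xs = there x∈xs

    cycle-hits : ∀ k → k mod suc (length xs) ≡ Any.index x∈x₀∷xs → cycle k ≡ x
    cycle-hits k k≡i = ≡.trans (cong (lookup (x₀ ∷ xs)) k≡i) (sym (lookup-index x∈x₀∷xs))

vecsBoundedBy : ∀ q → ℕ → List (Vec ℕ q)
vecsBoundedBy zero    b = [] ∷ []
vecsBoundedBy (suc q) b = cartesianProductWith _∷_ (upTo (suc b)) (vecsBoundedBy q b)

∈-vecsBoundedBy : ∀ {q b} (v : Vec ℕ q) → size v ≤ b → v ∈ vecsBoundedBy q b
∈-vecsBoundedBy []      _       = here refl
∈-vecsBoundedBy (a ∷ v) a+|v|≤b = ∈-cartesianProductWith⁺ _∷_
  (∈-upTo⁺ (s≤s (m+n≤o⇒m≤o a a+|v|≤b))) (∈-vecsBoundedBy v (m+n≤o⇒n≤o a a+|v|≤b))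

IsLeast : (ℕ → Set) → ℕ → Set
IsLeast R m = R m × (∀ j → R j → m ≤ j)

module Classical (em : ExcludedMiddle 0ℓ) where

  dne : DoubleNegationElimination 0ℓ
  dne = em⇒dne em

  unbounded-⊎ : ∀ {A B : ℕ → Set} → Unbounded (λ i → A i ⊎ B i) → Unbounded A ⊎ Unbounded B
  unbounded-⊎ {A} {B} A⊎B-unbounded with em {Unbounded A}
  ... | yes A-unbounded = inj₁ A-unbounded
  ... | no ¬A-unbounded = inj₂ B-unbounded
    where
    eventually-¬A : ∃ λ N → ∀ i → N ≤ i → ¬ A i
    eventually-¬A = dne λ ¬eventually → ¬A-unbounded λ N →
      dne λ ¬later → ¬eventually (N , λ i N≤i Ai → ¬later (i , N≤i , Ai))

    B-unbounded : Unbounded B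
    B-unbounded M =
      let (N , ¬A) = eventually-¬A
          (i , N+M≤i , A⊎B) = A⊎B-unbounded (N + M)
      in i , ≤-trans (m≤n+m M N) N+M≤i
           , [ (λ Ai → ⊥-elim (¬A i (≤-trans (m≤m+n N M) N+M≤i) Ai)) , id ]′ A⊎B

  unbounded-Any : ∀ {A : Set} {R : ℕ → A → Set} (xs : List A) →
    Unbounded (λ i → Any (R i) xs) → Any (λ x → Unbounded (λ i → R i x)) xs
  unbounded-Any []       Any-unbounded with Any-unbounded 0
  ... | _ , _ , ()
  unbounded-Any (x ∷ xs) Any-unbounded =
    [ here , there ∘ unbounded-Any xs ]′ (unbounded-⊎ (unbounded-map (λ _ → Any.toSum) Any-unbounded))

  least-witness : ∀ {R : ℕ → Set} → ∃ R → ∃ (IsLeast R)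
  least-witness {R} (k , Rk) = go k (<-wellFounded k) Rk
    where
    go : ∀ k → Acc _<_ k → R k → ∃ (IsLeast R)
    go k (acc smaller) Rk with em {∃ λ j → j < k × R j}
    ... | yes (j , j<k , Rj) = go j (smaller j<k) Rj
    ... | no ¬below = k , Rk , λ j Rj → ≮⇒≥ λ j<k → ¬below (j , j<k , Rj)

size-+ : ∀ {q} (u v : Config q) → size (zipWith _+_ u v) ≡ size u + size v
size-+ []      []      = refl
size-+ (a ∷ u) (b ∷ v) = ≡.trans (cong (a + b +_) (size-+ u v)) (interchange a b (size u) (size v))

size-∸ : ∀ {q} {x C : Config q} → x ≼ C → size (zipWith _∸_ C x) + size x ≡ size C
size-∸ []                           = refl
size-∸ {x = a ∷ x} {c ∷ C} (a≤c ∷ x≼C) = begin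
  (c ∸ a + size (zipWith _∸_ C x)) + (a + size x) ≡⟨ interchange (c ∸ a) _ a (size x) ⟩
  (c ∸ a + a) + (size (zipWith _∸_ C x) + size x) ≡⟨ cong₂ _+_ (m∸n+n≡m a≤c) (size-∸ x≼C) ⟩
  c + size C                                     ∎
  where open ≡-Reasoning

≼⇒size≤ : ∀ {q} {x C : Config q} → x ≼ C → size x ≤ size C
≼⇒size≤ []          = z≤n
≼⇒size≤ (a≤c ∷ x≼C) = +-mono-≤ a≤c (≼⇒size≤ x≼C)

size-replicate-0 : ∀ q → size (replicate q 0) ≡ 0
size-replicate-0 zero    = refl
size-replicate-0 (suc q) = size-replicate-0 q

replicate-0-≼ : ∀ {q} (C : Config q) → replicate q 0 ≼ C
replicate-0-≼ []      = []
replicate-0-≼ (_ ∷ C) = z≤n ∷ replicate-0-≼ C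

module _ {q n : ℕ} (P : ReplicatedSystem q n) where
  open ReplicatedSystem P

  infix 4 _⇒_ _⇒*_
  _⇒_ _⇒*_ : Config q → Config q → Set
  _⇒_  = _⟶_ P
  _⇒*_ = _⟶*_ P

  step-size : ∀ {C t D} → Step P C t D → size D ≡ size C
  step-size {C} {x , y} (xTy , x≼C , refl) = begin
    size (zipWith _+_ (zipWith _∸_ C x) y) ≡⟨ size-+ (zipWith _∸_ C x) y ⟩
    size (zipWith _∸_ C x) + size y       ≡⟨ cong (size (zipWith _∸_ C x) +_) (sym (T-size x y xTy)) ⟩
    size (zipWith _∸_ C x) + size x       ≡⟨ size-∸ x≼C ⟩
    size C                                 ∎
    where open ≡-Reasoning

  silent-step : ∀ C → Step P C (replicate q 0 , replicate q 0) C
  silent-step C =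
      T-silent ∅ (subst (_≤ n) (sym (size-replicate-0 q)) z≤n)
    , replicate-0-≼ C
    , sym (≡.trans (zipWith-identityʳ +-identityʳ _) (zipWith-identityʳ (λ _ → refl) C))
    where
    ∅ : Config q
    ∅ = replicate q 0

  Recurs : Run P → Config q → Set
  Recurs r C = InfinitelyOften P (λ i → conf r i ≡ C)

  run-size : (r : Run P) → ∀ i → size (conf r i) ≡ size (conf r 0)
  run-size r zero    = refl
  run-size r (suc i) = ≡.trans (step-size (step r i)) (run-size r i)

  recurrent-size : ∀ {r C} → Recurs r C → size C ≡ size (conf r 0)
  recurrent-size {r} C-recurs =
    let (i , _ , conf-i≡C) = C-recurs 0 in subst (λ D → size D ≡ size (conf r 0)) conf-i≡C (run-size r i)

  run-⇒* : (r : Run P) → ∀ {i j} → i ≤ j → conf r i ⇒* conf r j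
  run-⇒* r {j = zero}  z≤n   = ε
  run-⇒* r {j = suc j} i≤1+j with m≤n⇒m<n∨m≡n i≤1+j
  ... | inj₁ i<1+j = run-⇒* r (≤-pred i<1+j) ◅◅ ((trans r j , step r j) ◅ ε)
  ... | inj₂ refl  = ε

  run-stays-in : ∀ {𝒞} → Inductive P 𝒞 → (r : Run P) → 𝒞 (conf r 0) → ∀ i → 𝒞 (conf r i)
  run-stays-in ind r C₀∈𝒞 zero    = C₀∈𝒞
  run-stays-in ind r C₀∈𝒞 (suc i) = ind _ _ (run-stays-in ind r C₀∈𝒞 i) (trans r i , step r i)

  fair-recurs-⇒ : ∀ {r C D} → Fair P r → C ⇒ D → Recurs r C → Recurs r D
  fair-recurs-⇒ fair (t , C→D) C-recurs N =
    let (i , N≤i , _ , _ , conf-1+i≡D) = fair _ t _ C→D C-recurs N in suc i , m≤n⇒m≤1+n N≤i , conf-1+i≡D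

  fair-recurs-⇒* : ∀ {r C D} → Fair P r → C ⇒* D → Recurs r C → Recurs r D
  fair-recurs-⇒* fair ε          = id
  fair-recurs-⇒* {r} fair (C⇒ ◅ ⇒*D) = fair-recurs-⇒* {r} fair ⇒*D ∘ fair-recurs-⇒ {r} fair C⇒

  certified-not-recurrent : ∀ {𝒞 𝒞' f} → Certificate P 𝒞 𝒞' f → ∀ {r} → Fair P r →
    (∀ i → ¬ 𝒞' (conf r i)) → ∀ D (D∈𝒞 : 𝒞 D) → ¬ Recurs r D
  certified-not-recurrent {𝒞} {𝒞'} {f} cert {r} fair avoids D D∈𝒞 = descend (suc (f D D∈𝒞)) D D∈𝒞 ≤-refl
    where
    descend : ∀ v D (D∈𝒞 : 𝒞 D) → f D D∈𝒞 < v → ¬ Recurs r D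
    descend (suc v) D D∈𝒞 fD<1+v D-recurs =
      let (i , _ , conf-i≡D)      = D-recurs 0
          (E , D⇒*E , E∈𝒞 , fE<fD) = cert D D∈𝒞 (avoids i ∘ subst 𝒞' (sym conf-i≡D))
      in descend v E E∈𝒞 (≤-trans fE<fD (≤-pred fD<1+v)) (fair-recurs-⇒* {r} fair D⇒*E D-recurs)

  ReachesIn : ConfigSet P → ℕ → Config q → Set
  ReachesIn 𝒞' zero    C = 𝒞' C
  ReachesIn 𝒞' (suc k) C = ∃ λ D → C ⇒ D × ReachesIn 𝒞' k D

  run-reachesIn : ∀ 𝒞' (r : Run P) k i → 𝒞' (conf r (k + i)) → ReachesIn 𝒞' k (conf r i)
  run-reachesIn 𝒞' r zero    i C∈𝒞' = C∈𝒞'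
  run-reachesIn 𝒞' r (suc k) i C∈𝒞' = conf r (suc i) , (trans r i , step r i) ,
    run-reachesIn 𝒞' r k (suc i) (subst (𝒞' ∘ conf r) (sym (+-suc k i)) C∈𝒞')

  module _ (em : ExcludedMiddle 0ℓ) where
    open Classical em

    recurrent-configuration : (r : Run P) → ∃ (Recurs r)
    recurrent-configuration r = Any.satisfied (unbounded-Any (vecsBoundedBy q (size (conf r 0)))
      λ N → N , ≤-refl , ∈-vecsBoundedBy (conf r N) (≤-reflexive (run-size r N)))

    module FairRun (C₀ : Config q) where

      Target : Set
      Target = Config q × Transition P × Config q

      targets : List Target
      targets = cartesianProduct Cs (cartesianProduct (cartesianProduct Cs Cs) Cs)
        where
        Cs : List (Config q)
        Cs = vecsBoundedBy q (size C₀)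

      ∈-targets : ∀ {C t C'} → Step P C t C' → size C ≡ size C₀ → (C , t , C') ∈ targets
      ∈-targets {C} {x , y} {C'} C→C'@(xTy , x≼C , _) |C|≡|C₀| =
        ∈-cartesianProduct⁺ (bounded C ≤-refl)
          (∈-cartesianProduct⁺
            (∈-cartesianProduct⁺ (bounded x |x|≤|C|) (bounded y (≤-trans (≤-reflexive (sym (T-size x y xTy))) |x|≤|C|)))
            (bounded C' (≤-reflexive (step-size C→C'))))
        where
        |x|≤|C| : size x ≤ size C
        |x|≤|C| = ≼⇒size≤ x≼C

        bounded : (v : Config q) → size v ≤ size C → v ∈ vecsBoundedBy q (size C₀)
        bounded v |v|≤|C| = ∈-vecsBoundedBy v (≤-trans |v|≤|C| (≤-reflexive |C|≡|C₀|))

      target : ℕ → Target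
      target = cycle (C₀ , (C₀ , C₀) , C₀) targets

      infix 4 _▸_
      record Segment (E : Config q) : Set where
        constructor _▸_
        field
          {mid end} : Config q
          {label}   : Transition P
          walk      : E ⇒* mid
          fire      : Step P mid label end
      open Segment

      endpoints : ∀ {E} → Segment E → Target
      endpoints s = mid s , label s , end s

      Hits : Config q → Target → Set
      Hits E (C , t , C') = E ⇒* C × Step P C t C'

      aim : ∀ E τ → Dec (Hits E τ) → Segment E
      aim E (C , t , C') (yes (walk , fire)) = walk ▸ fire
      aim E _            (no _)              = ε ▸ silent-step E

      aim-hits : ∀ E τ (d : Dec (Hits E τ)) → Hits E τ → endpoints (aim E τ d) ≡ τ
      aim-hits E (C , t , C') (yes _)    _    = refl
      aim-hits E τ            (no ¬hits) hits = ⊥-elim (¬hits hits)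

      plan : ℕ → (E : Config q) → Segment E
      plan k E = aim E (target k) em

      record Cursor : Set where
        constructor cursor
        field
          phase      : ℕ
          {position} : Config q
          segment    : Segment position
      open Cursor

      next : Cursor → Cursor
      next (cursor k (_▸_ {end = G} ε _)) = cursor (suc k) (plan (suc k) G)
      next (cursor k (_ ◅ walk ▸ fire))   = cursor k (walk ▸ fire)

      emitted : Cursor → Transition P
      emitted (cursor _ (_▸_ {label = t} ε _)) = t
      emitted (cursor _ ((t , _) ◅ _ ▸ _))     = t

      emitted-step : ∀ c → Step P (position c) (emitted c) (position (next c))
      emitted-step (cursor _ (ε ▸ fire))         = fire
      emitted-step (cursor _ ((_ , C→) ◅ _ ▸ _)) = C→

      firing : Cursor → Target
      firing c = position c , emitted c , position (next c)

      cursorAt : ℕ → Cursor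
      cursorAt zero    = cursor 0 (plan 0 C₀)
      cursorAt (suc i) = next (cursorAt i)

      run : Run P
      run = record { conf = position ∘ cursorAt ; trans = emitted ∘ cursorAt ; step = emitted-step ∘ cursorAt }

      segment-completes : ∀ p {k E} (seg : Segment E) → cursorAt p ≡ cursor k seg →
        ∃ λ j → p ≤ j × firing (cursorAt j) ≡ endpoints seg
                      × cursorAt (suc j) ≡ cursor (suc k) (plan (suc k) (end seg))
      segment-completes p (ε ▸ _)           at-p = p , ≤-refl , cong firing at-p , cong next at-p
      segment-completes p (_ ◅ walk ▸ fire) at-p =
        let (j , 1+p≤j , fires , after) = segment-completes (suc p) (walk ▸ fire) (cong next at-p)
        in j , <⇒≤ 1+p≤j , fires , after

      phase-starts : ∀ k → ∃ λ p → k ≤ p × ∃ λ E → cursorAt p ≡ cursor k (plan k E)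
      phase-starts zero    = 0 , z≤n , C₀ , refl
      phase-starts (suc k) =
        let (p , k≤p , E , at-p)     = phase-starts k
            (j , p≤j , _ , at-1+j) = segment-completes p (plan k E) at-p
        in suc j , s≤s (≤-trans k≤p p≤j) , _ , at-1+j

      -- C recurs after the start of phase K, so the step targeted by phase K is reachable.
      phase-fires-target : ∀ {C t C'} → Step P C t C' → Recurs run C →
        ∀ K → target K ≡ (C , t , C') → ∃ λ j → K ≤ j × firing (cursorAt j) ≡ (C , t , C')
      phase-fires-target C→C' C-recurs K target-K≡ =
        let (p , K≤p , E , at-p)  = phase-starts K
            (i , p≤i , conf-i≡C) = C-recurs p
            E⇒*C                 = subst₂ _⇒*_ (cong position at-p) conf-i≡C (run-⇒* run p≤i)
            hits                 = subst (Hits E) (sym target-K≡) (E⇒*C , C→C')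
            (j , p≤j , fires , _) = segment-completes p (plan K E) at-p
        in j , ≤-trans K≤p p≤j , ≡.trans fires (≡.trans (aim-hits E (target K) em hits) target-K≡)

      run-fair : Fair P run
      run-fair C t C' C→C' C-recurs N =
        let (K , N≤K , target-K≡) = cycle-unbounded _ targets (∈-targets C→C' (recurrent-size {run} C-recurs)) N
            (j , K≤j , fires)     = phase-fires-target C→C' C-recurs K target-K≡
            (conf-j≡C , rest)     = ,-injective fires
        in j , ≤-trans N≤K K≤j , conf-j≡C , ,-injective rest

    fair-run : ∀ C₀ → Σ (Run P) λ r → conf r 0 ≡ C₀ × Fair P r
    fair-run C₀ = run , refl , run-fair
      where open FairRun C₀

    certificate⇒leadsTo : ∀ {𝒞 𝒞'} → Inductive P 𝒞 →
      Σ ((C : Config q) → 𝒞 C → ℕ) (Certificate P 𝒞 𝒞') → LeadsTo P 𝒞 𝒞'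
    certificate⇒leadsTo {𝒞} ind (f , cert) C C∈𝒞 r refl fair = dne λ never →
      let (D , D-recurs)     = recurrent-configuration r
          (i , _ , conf-i≡D) = D-recurs 0
      in certified-not-recurrent cert {r} fair (curry never) D
           (subst 𝒞 conf-i≡D (run-stays-in ind r C∈𝒞 i)) D-recurs

    leadsTo⇒reaches : ∀ {𝒞 𝒞'} → LeadsTo P 𝒞 𝒞' → ∀ {C} → 𝒞 C → ∃ λ k → ReachesIn 𝒞' k C
    leadsTo⇒reaches {𝒞' = 𝒞'} leads {C} C∈𝒞 =
      let (r , conf-0≡C , fair) = fair-run C
          (i , conf-i∈𝒞')       = leads C C∈𝒞 r conf-0≡C fair
      in i , subst (ReachesIn 𝒞' i) conf-0≡C
               (run-reachesIn 𝒞' r i 0 (subst (𝒞' ∘ conf r) (sym (+-identityʳ i)) conf-i∈𝒞'))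

    leadsTo⇒certificate : ∀ {𝒞 𝒞'} → Inductive P 𝒞 → LeadsTo P 𝒞 𝒞' →
      Σ ((C : Config q) → 𝒞 C → ℕ) (Certificate P 𝒞 𝒞')
    leadsTo⇒certificate {𝒞} {𝒞'} ind leads = rank , rank-decreases
      where
      least-reach : ∀ C → 𝒞 C → ∃ (IsLeast λ m → ReachesIn 𝒞' m C)
      least-reach C C∈𝒞 = least-witness (leadsTo⇒reaches {𝒞} {𝒞'} leads C∈𝒞)

      rank : (C : Config q) → 𝒞 C → ℕ
      rank C C∈𝒞 = proj₁ (least-reach C C∈𝒞)

      rank-decreases : Certificate P 𝒞 𝒞' rank
      rank-decreases C C∈𝒞 C∉𝒞' = first-step (least-reach C C∈𝒞)
        where
        first-step : (least : ∃ (IsLeast λ m → ReachesIn 𝒞' m C)) →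
          ∃ λ D → Σ (C ⇒* D) λ _ → Σ (𝒞 D) λ D∈𝒞 → rank D D∈𝒞 < proj₁ least
        first-step (zero  , C∈𝒞'                 , _) = ⊥-elim (C∉𝒞' C∈𝒞')
        first-step (suc m , (D , C⇒D , D-reaches) , _) =
          D , C⇒D ◅ ε , D∈𝒞 , s≤s (proj₂ (proj₂ (least-reach D D∈𝒞)) m D-reaches)
          where
          D∈𝒞 : 𝒞 D
          D∈𝒞 = ind C D C∈𝒞 C⇒D

proposition2 : ExcludedMiddle 0ℓ → {q n : ℕ} (P : ReplicatedSystem q n)
    (𝒞 𝒞' : ConfigSet P) → Inductive P 𝒞 → Inductive P 𝒞' →
    LeadsTo P 𝒞 𝒞' ⇔ Σ ((C : Config q) → 𝒞 C → ℕ) (Certificate P 𝒞 𝒞')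
proposition2 em P 𝒞 𝒞' ind _ = mk⇔ (leadsTo⇒certificate P em ind) (certificate⇒leadsTo P em ind)
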